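{- Let $n\ge 4$ be even and let $D$ be a $C_3$-simple orientation of the wheel $W_n$. Then the directed metric dimension of $D$ is $\dim(D)=2$ if $n=4$, and $\dim(D)=\frac{n}{2}-1$ if $n\ge 6$.
   Context: The wheel $W_n$ is $K_1+C_n$: a center vertex $c$ adjacent to every vertex of a cycle $v_1v_2\cdots v_nv_1$. An orientation is $C_3$-simple if every triangle of the underlying graph becomes a directed (strongly connected) $3$-cycle. For a strongly connected oriented graph $D$ and vertices $u,v$, $d(u,v)$ is the minimum length of a directed path from $u$ to $v$. For a nonempty ordered set $B=\{b_1,\dots,b_k\}\subseteq V(D)$, the representation of $v$ is $r(v|B)=(d(v,b_1),\dots,d(v,b_k))$; $B$ is a resolving set if $r(u|B)\ne r(v|B)$ for all distinct $u,v$. The directed metric dimension $\dim(D)$ is the minimum cardinality of a resolving set. -}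

module Defs where

open import Data.Nat using (ℕ; zero; suc; _≤_)
open import Data.Nat.DivMod using (_mod_)
open import Data.Fin using (Fin; zero; suc; toℕ)
open import Data.Fin.Subset using (Subset; _∈_)
open import Data.Bool using (Bool; true; false)
open import Data.Product using (Σ; _×_; ∃)
open import Data.Sum using (_⊎_)
open import Relation.Binary.PropositionalEquality using (_≡_)

-- Wheel W_n : vertex set Fin (suc n); zero is the centre c,
-- suc i is the rim vertex v_(i+1), i : Fin n.
-- rim successor of index i (cyclically): i ↦ i+1 mod n
next : {n : ℕ} → Fin n → Fin n
next {suc m} i = suc (toℕ i) mod (suc m)

-- An orientation of W_n: a direction for each spoke and each rim edge.
-- spoke i = true  means  c → v_i ;  false means v_i → c
-- rim   i = true  means  v_i → v_(i+1) ; false means v_(i+1) → v_i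
record Orientation (n : ℕ) : Set where
  field
    spoke : Fin n → Bool
    rim   : Fin n → Bool

open Orientation public

data Arc {n : ℕ} (o : Orientation n) : Fin (suc n) → Fin (suc n) → Set where
  spokeOut : ∀ i → spoke o i ≡ true  → Arc o zero (suc i)
  spokeIn  : ∀ i → spoke o i ≡ false → Arc o (suc i) zero
  rimFwd   : ∀ i → rim o i ≡ true  → Arc o (suc i) (suc (next i))
  rimBwd   : ∀ i → rim o i ≡ false → Arc o (suc (next i)) (suc i)

Adj : {n : ℕ} → Orientation n → Fin (suc n) → Fin (suc n) → Set
Adj o u v = Arc o u v ⊎ Arc o v u

-- C3-simple: every triangle {x,y,z} of the underlying graph is a directed
-- 3-cycle, i.e. whenever x → y and {y,z},{z,x} are edges, then y → z
-- (and, by rotating, z → x).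
C3Simple : {n : ℕ} → Orientation n → Set
C3Simple o = ∀ x y z → Arc o x y → Adj o y z → Adj o z x → Arc o y z

data Path {n : ℕ} (o : Orientation n) : ℕ → Fin (suc n) → Fin (suc n) → Set where
  here : ∀ {u} → Path o zero u u
  step : ∀ {k u v w} → Arc o u v → Path o k v w → Path o (suc k) u w

Dist : {n : ℕ} → Orientation n → Fin (suc n) → Fin (suc n) → ℕ → Set
Dist o u v k = Path o k u v × (∀ m → Path o m u v → k ≤ m)

SameRep : {n : ℕ} → Orientation n → Subset (suc n) → Fin (suc n) → Fin (suc n) → Set
SameRep o B u v = ∀ b → b ∈ B → ∃ λ k → Dist o u b k × Dist o v b k

Resolving : {n : ℕ} → Orientation n → Subset (suc n) → Set
Resolving o B = ∀ u v → SameRep o B u v → u ≡ v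

open import Data.Fin.Subset using (∣_∣)
DimIs : {n : ℕ} → Orientation n → ℕ → Set
DimIs {n} o m = (∃ λ (B : Subset (suc n)) → Resolving o B × ∣ B ∣ ≡ m)
              × (∀ (B : Subset (suc n)) → Resolving o B → m ≤ ∣ B ∣)

-- If every triangle c v_i v_(i+1) is a directed 3-cycle, the spokes alternate between
-- out-spokes c → v_i (Out vertices) and in-spokes v_i → c (In vertices), and each rim edge is
-- forced by its spoke; all distances are then explicit. Two In vertices have equal distances to every third vertex, so a resolving set
-- misses at most one of the n/2 In vertices. For n ≥ 6 all In vertices but one t₀ resolve: the
-- distance to an In vertex j ≠ t₀ distinguishes the centre (2), In vertices (0 or 3) and Out vertices
-- (1 or 4); an In vertex sees itself at distance 0 and the other In vertices at 3; and an Out vertex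
-- is determined by its In neighbours other than t₀, because two Out vertices share at most one
-- neighbour once n ≥ 5. For n = 4 the two Out vertices are twins too, which forces dimension 2.
module Submission where

open import Defs
open import Data.Bool as Bool using (Bool; true; false; not; if_then_else_)
open import Data.Bool.Properties using (not-injective; not-involutive)
open import Data.Empty using (⊥; ⊥-elim)
open import Data.Fin using (Fin; zero; suc; toℕ; fromℕ; inject₁)
open import Data.Fin.Properties
  using (_≟_; suc-injective; toℕ-injective; toℕ-fromℕ<; toℕ-fromℕ; toℕ<n; toℕ≤pred[n]; toℕ-inject₁; any?; all?)
open import Data.Fin.Subset using (Subset; _∈_; _∉_; _⊆_; _-_; ∣_∣; inside; outside)
open import Data.Fin.Subset.Properties
  using (_∈?_; p─⊥≡p; p─q⊆p; p⊆q⇒∣p∣≤∣q∣; x∈p⇒∣p-x∣<∣p∣; x∈p∧x≢y⇒x∈p-y)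
open import Data.Maybe using (Maybe; just; nothing)
open import Data.Maybe.Properties using (just-injective)
open import Data.Nat as ℕ using (ℕ; zero; suc; _+_; _*_; _∸_; _%_; _<_; _≤_; z≤n; s≤s; s≤s⁻¹)
open import Data.Nat.DivMod using (n%n≡0; m<n⇒m%n≡m)
open import Data.Nat.Properties
  using (≤-refl; ≤-reflexive; ≤-trans; ≤-antisym; ≤∧≢⇒<; <-irrefl; m≤n⇒m≤1+n; m≤n+o⇒m∸n≤o; n≤1+n; *-comm)
open import Data.Product using (∃; _×_; _,_)
open import Data.Sum using (_⊎_; inj₁; inj₂; swap)
open import Data.Vec using ([]; _∷_; here; there; tabulate)
open import Data.Vec.Properties using (lookup∘tabulate; lookup⇒[]=; []=⇒lookup)
open import Function using (_∘_; case_of_)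
open import Relation.Nullary using (Dec; yes; no; does; ¬?)
open import Relation.Nullary.Decidable using (_×-dec_; _⊎-dec_; _→-dec_; decidable-stable; toWitness)
open import Relation.Binary.PropositionalEquality

data SuccView (m : ℕ) : ℕ → ℕ → Set where
  wrap : SuccView m m 0
  inc  : ∀ {a} → a < m → SuccView m a (suc a)

next-view : ∀ {m} (i : Fin (suc m)) → SuccView m (toℕ i) (toℕ (next i))
next-view {m} i with toℕ i ℕ.≟ m
... | yes i≡m = subst₂ (SuccView m) (sym i≡m) (sym next≡0) wrap
  where
  open ≡-Reasoning
  next≡0 : toℕ (next i) ≡ 0
  next≡0 = begin
    toℕ (next i)        ≡⟨ toℕ-fromℕ< _ ⟩
    suc (toℕ i) % suc m ≡⟨ cong (λ a → suc a % suc m) i≡m ⟩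
    suc m % suc m       ≡⟨ n%n≡0 (suc m) ⟩
    0                   ∎
... | no i≢m = subst (SuccView m (toℕ i)) (sym (trans (toℕ-fromℕ< _) (m<n⇒m%n≡m (s≤s i<m)))) (inc i<m)
  where
  i<m : toℕ i < m
  i<m = ≤∧≢⇒< (toℕ≤pred[n] i) i≢m

SuccView-injective : ∀ {m a c b} → SuccView m a b → SuccView m c b → a ≡ c
SuccView-injective wrap    wrap    = refl
SuccView-injective (inc _) (inc _) = refl

SuccView-functional : ∀ {m a b c} → SuccView m a b → SuccView m a c → b ≡ c
SuccView-functional wrap      wrap      = refl
SuccView-functional wrap      (inc m<m) = ⊥-elim (<-irrefl refl m<m)
SuccView-functional (inc m<m) wrap      = ⊥-elim (<-irrefl refl m<m)
SuccView-functional (inc _)   (inc _)   = refl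

next-injective : ∀ {m} {i j : Fin (suc m)} → next i ≡ next j → i ≡ j
next-injective {i = i} {j} e =
  toℕ-injective (SuccView-injective (next-view i) (subst (SuccView _ (toℕ j)) (cong toℕ (sym e)) (next-view j)))

next-of-toℕ-suc : ∀ {m} {i j : Fin (suc m)} → toℕ j ≡ suc (toℕ i) → next i ≡ j
next-of-toℕ-suc {m} {i} {j} e = toℕ-injective (SuccView-functional (next-view i) view-j)
  where
  view-j : SuccView m (toℕ i) (toℕ j)
  view-j = subst (SuccView m (toℕ i)) (sym e) (inc (s≤s⁻¹ (subst (_< suc m) e (toℕ<n j))))

next-surjective : ∀ {m} (i : Fin (suc m)) → ∃ λ p → next p ≡ i
next-surjective {m} zero = fromℕ m , toℕ-injective (SuccView-functional (next-view (fromℕ m)) last)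
  where
  last : SuccView m (toℕ (fromℕ m)) 0
  last = subst (λ a → SuccView m a 0) (sym (toℕ-fromℕ m)) wrap
next-surjective {suc m} (suc i) = inject₁ i , next-of-toℕ-suc (cong suc (sym (toℕ-inject₁ i)))

SuccView-2-cycle : ∀ {m a b c} → SuccView m a b → SuccView m b c → c ≡ a → 2 ≤ m → ⊥
SuccView-2-cycle wrap    wrap    refl ()
SuccView-2-cycle wrap    (inc _) refl (s≤s ())
SuccView-2-cycle (inc _) wrap    refl (s≤s ())

SuccView-4-cycle : ∀ {m a b c d e} → SuccView m a b → SuccView m b c → SuccView m c d → SuccView m d e →
                   e ≡ a → 4 ≤ m → ⊥
SuccView-4-cycle wrap    wrap    _       _       _    ()
SuccView-4-cycle wrap    (inc _) wrap    _       _    (s≤s ())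
SuccView-4-cycle _       wrap    (inc _) wrap    _    (s≤s ())
SuccView-4-cycle wrap    (inc _) (inc _) wrap    _    (s≤s (s≤s ()))
SuccView-4-cycle wrap    (inc _) (inc _) (inc _) refl (s≤s (s≤s (s≤s ())))
SuccView-4-cycle (inc _) wrap    (inc _) (inc _) refl (s≤s (s≤s (s≤s ())))
SuccView-4-cycle (inc _) (inc _) wrap    (inc _) refl (s≤s (s≤s (s≤s ())))
SuccView-4-cycle (inc _) (inc _) (inc _) wrap    refl (s≤s (s≤s (s≤s ())))

next²≢id : ∀ {m} → 2 ≤ m → (i : Fin (suc m)) → next (next i) ≢ i
next²≢id 2≤m i e = SuccView-2-cycle (next-view i) (next-view (next i)) (cong toℕ e) 2≤m

next⁴≢id : ∀ {m} → 4 ≤ m → (i : Fin (suc m)) → next (next (next (next i))) ≢ i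
next⁴≢id 4≤m i e = SuccView-4-cycle (next-view i) (next-view (next i)) (next-view (next (next i)))
  (next-view (next (next (next i)))) (cong toℕ e) 4≤m

∣p∣≡1+∣p-x∣ : ∀ {n} {x : Fin n} {p : Subset n} → x ∈ p → ∣ p ∣ ≡ suc ∣ p - x ∣
∣p∣≡1+∣p-x∣ {p = inside ∷ p}  here        = cong (suc ∘ ∣_∣) (sym (p─⊥≡p p))
∣p∣≡1+∣p-x∣ {p = inside ∷ p}  (there x∈p) = cong suc (∣p∣≡1+∣p-x∣ x∈p)
∣p∣≡1+∣p-x∣ {p = outside ∷ p} (there x∈p) = ∣p∣≡1+∣p-x∣ x∈p

x∉p-x : ∀ {n} {x : Fin n} {p : Subset n} → x ∉ p - x
x∉p-x {x = zero}  {_ ∷ _} ()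
x∉p-x {x = suc x} {_ ∷ _} (there x∈p-x) = x∉p-x x∈p-x

x∈p-y⇒x≢y : ∀ {n} {x y : Fin n} {p : Subset n} → x ∈ p - y → x ≢ y
x∈p-y⇒x≢y x∈p-x refl = x∉p-x x∈p-x

∣p∣≤1+∣q∣ : ∀ {n} {p q : Subset n} → (∀ {x y} → x ∈ p → x ∉ q → y ∈ p → y ∉ q → x ≡ y) →
           ∣ p ∣ ≤ suc ∣ q ∣
∣p∣≤1+∣q∣ {p = p} {q} unique with any? (λ x → (x ∈? p) ×-dec ¬? (x ∈? q))
... | no ¬outlier = m≤n⇒m≤1+n (p⊆q⇒∣p∣≤∣q∣ p⊆q)
  where
  p⊆q : p ⊆ q
  p⊆q {x} x∈p = decidable-stable (x ∈? q) (λ x∉q → ¬outlier (x , x∈p , x∉q))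
... | yes (t , t∈p , t∉q) = subst (_≤ suc ∣ q ∣) (sym (∣p∣≡1+∣p-x∣ t∈p)) (s≤s (p⊆q⇒∣p∣≤∣q∣ p-t⊆q))
  where
  p-t⊆q : p - t ⊆ q
  p-t⊆q {x} x∈p-t = decidable-stable (x ∈? q)
    (λ x∉q → x∈p-y⇒x≢y x∈p-t (unique (p─q⊆p p _ x∈p-t) x∉q t∈p t∉q))

2≤∣p∣ : ∀ {n} {x y : Fin n} {p : Subset n} → x ∈ p → y ∈ p → x ≢ y → 2 ≤ ∣ p ∣
2≤∣p∣ {x = x} {p = p} x∈p y∈p x≢y = ≤-trans (s≤s 1≤∣p-x∣) (x∈p⇒∣p-x∣<∣p∣ x∈p)
  where
  1≤∣p-x∣ : 1 ≤ ∣ p - x ∣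
  1≤∣p-x∣ = ≤-trans (s≤s z≤n) (x∈p⇒∣p-x∣<∣p∣ (x∈p∧x≢y⇒x∈p-y y∈p (x≢y ∘ sym)))

Alternating : ∀ {L} → (Fin L → Bool) → Set
Alternating f = ∀ i j → toℕ j ≡ suc (toℕ i) → f j ≡ not (f i)

∣b∷¬b∷p∣ : ∀ {n} b (p : Subset n) → ∣ b ∷ not b ∷ p ∣ ≡ suc ∣ p ∣
∣b∷¬b∷p∣ true  p = refl
∣b∷¬b∷p∣ false p = refl

∣alternating∣≡half : ∀ {L} k → L ≡ k * 2 → (f : Fin L → Bool) → Alternating f → ∣ tabulate f ∣ ≡ k
∣alternating∣≡half zero    refl f alt = refl
∣alternating∣≡half (suc k) refl f alt = begin
  ∣ f zero ∷ f (suc zero) ∷ tabulate f′ ∣  ≡⟨ cong (λ b → ∣ f zero ∷ b ∷ tabulate f′ ∣) (alt zero (suc zero) refl) ⟩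
  ∣ f zero ∷ not (f zero) ∷ tabulate f′ ∣ ≡⟨ ∣b∷¬b∷p∣ (f zero) (tabulate f′) ⟩
  suc ∣ tabulate f′ ∣                     ≡⟨ cong suc (∣alternating∣≡half k refl f′ alt′) ⟩
  suc k                                   ∎
  where
  open ≡-Reasoning
  f′ : Fin (k * 2) → Bool
  f′ i = f (suc (suc i))
  alt′ : Alternating f′
  alt′ i j e = alt (suc (suc i)) (suc (suc j)) (cong (λ a → suc (suc a)) e)

_++ᵖ_ : ∀ {n} {o : Orientation n} {a b u v w} → Path o a u v → Path o b v w → Path o (a + b) u w
here      ++ᵖ q = q
step uv p ++ᵖ q = step uv (p ++ᵖ q)

Twins : ∀ {n} → Orientation n → Fin (suc n) → Fin (suc n) → Set
Twins o u v = ∀ b → b ≢ u → b ≢ v → ∃ λ k → Dist o u b k × Dist o v b k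

module _ {n} {o : Orientation n} {B : Subset (suc n)} (resolving : Resolving o B) where

  twins-outside⇒≡ : ∀ {u v} → Twins o u v → u ∉ B → v ∉ B → u ≡ v
  twins-outside⇒≡ twins u∉B v∉B =
    resolving _ _ λ b b∈B → twins b (λ { refl → u∉B b∈B }) (λ { refl → v∉B b∈B })

  twins-meet : ∀ {u v} → Twins o u v → u ≢ v → u ∈ B ⊎ v ∈ B
  twins-meet {u} {v} twins u≢v with u ∈? B | v ∈? B
  ... | yes u∈B | _       = inj₁ u∈B
  ... | no _    | yes v∈B = inj₂ v∈B
  ... | no u∉B  | no v∉B  = ⊥-elim (u≢v (twins-outside⇒≡ twins u∉B v∉B))

  twin-class-bound : ∀ {X : Subset (suc n)} → (∀ {u v} → u ∈ X → v ∈ X → Twins o u v) → ∣ X ∣ ≤ suc ∣ B ∣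
  twin-class-bound twins = ∣p∣≤1+∣q∣ λ u∈X u∉B v∈X v∉B → twins-outside⇒≡ (twins u∈X v∈X) u∉B v∉B

RimAdjacent : ∀ {N} → Fin N → Fin N → Set
RimAdjacent i j = j ≡ next i ⊎ i ≡ next j

rimAdjacent? : ∀ {N} (i j : Fin N) → Dec (RimAdjacent i j)
rimAdjacent? i j = (j ≟ next i) ⊎-dec (i ≟ next j)

module C3Wheel {N} {o : Orientation N} (c3 : C3Simple o) where

  rim-edge : ∀ i → Adj o (suc i) (suc (next i))
  rim-edge i with rim o i in e
  ... | true  = inj₁ (rimFwd i e)
  ... | false = inj₂ (rimBwd i e)

  spoke-edge : ∀ i → Adj o zero (suc i)
  spoke-edge i with spoke o i in e
  ... | true  = inj₁ (spokeOut i e)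
  ... | false = inj₂ (spokeIn i e)

  out-spoke : ∀ {i} → Arc o zero (suc i) → spoke o i ≡ true
  out-spoke (spokeOut _ e) = e

  in-spoke : ∀ {i} → Arc o (suc i) zero → spoke o i ≡ false
  in-spoke (spokeIn _ e) = e

  spoke-next : ∀ i → spoke o (next i) ≡ not (spoke o i)
  spoke-next i with spoke o i in e
  ... | true  = in-spoke (c3 _ _ _ rim-arc (swap (spoke-edge (next i))) (spoke-edge i))
    where rim-arc = c3 _ _ _ (spokeOut i e) (rim-edge i) (swap (spoke-edge (next i)))
  ... | false = out-spoke (c3 _ _ _ (spokeIn i e) (spoke-edge (next i)) (swap (rim-edge i)))

  rim≡spoke : ∀ i → rim o i ≡ spoke o i
  rim≡spoke i with rim o i in e
  ... | true  = sym (out-spoke (c3 _ _ _ spoke-arc (spoke-edge i) (rim-edge i)))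
    where spoke-arc = c3 _ _ _ (rimFwd i e) (swap (spoke-edge (next i))) (spoke-edge i)
  ... | false = sym (in-spoke (c3 _ _ _ (rimBwd i e) (swap (spoke-edge i)) (spoke-edge (next i))))

-- Distance between distinct rim vertices, given whether each is Out and whether they are adjacent:
-- Out→Out via v_i → v_{i+1} → c → v_j, In→In via v_i → c → v_{j+1} → v_j, In→Out via c, and a
-- non-adjacent Out→In pair via v_i → v_{i+1} → c → v_{j+1} → v_j.
rimDistance : ∀ {A : Set} → Bool → Bool → Dec A → ℕ
rimDistance true  true  _       = 3
rimDistance true  false (yes _) = 1
rimDistance true  false (no _)  = 4
rimDistance false true  _       = 2
rimDistance false false _       = 3

1≤rimDistance : ∀ {A : Set} a b (c : Dec A) → 1 ≤ rimDistance a b c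
1≤rimDistance true  true  _       = s≤s z≤n
1≤rimDistance true  false (yes _) = s≤s z≤n
1≤rimDistance true  false (no _)  = s≤s z≤n
1≤rimDistance false true  _       = s≤s z≤n
1≤rimDistance false false _       = s≤s z≤n

rimDistance≤4 : ∀ {A : Set} a b (c : Dec A) → rimDistance a b c ≤ 4
rimDistance≤4 true  true  _       = s≤s (s≤s (s≤s z≤n))
rimDistance≤4 true  false (yes _) = s≤s z≤n
rimDistance≤4 true  false (no _)  = ≤-refl
rimDistance≤4 false true  _       = s≤s (s≤s z≤n)
rimDistance≤4 false false _       = s≤s (s≤s (s≤s z≤n))

if≤2 : ∀ b → (if b then 1 else 2) ≤ 2
if≤2 true  = s≤s z≤n
if≤2 false = ≤-refl

true≢false : true ≢ false
true≢false ()

module WheelGraph {N} (σ : Fin N → Bool) where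

  -- σ i = true makes v_i an Out vertex (c → v_i), σ i = false an In vertex (v_i → c).

  data WheelArc : Fin (suc N) → Fin (suc N) → Set where
    centre→out : ∀ {j} → σ j ≡ true → WheelArc zero (suc j)
    in→centre  : ∀ {i} → σ i ≡ false → WheelArc (suc i) zero
    out→in     : ∀ {i j} → σ i ≡ true → σ j ≡ false → RimAdjacent i j → WheelArc (suc i) (suc j)

  δ : Fin (suc N) → Fin (suc N) → ℕ
  δ zero    zero    = 0
  δ zero    (suc j) = if σ j then 1 else 2
  δ (suc i) zero    = if σ i then 2 else 1
  δ (suc i) (suc j) = if does (i ≟ j) then 0 else rimDistance (σ i) (σ j) (rimAdjacent? i j)

  δ-refl : ∀ u → δ u u ≡ 0
  δ-refl zero    = refl
  δ-refl (suc i) with i ≟ i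
  ... | yes _  = refl
  ... | no i≢i = ⊥-elim (i≢i refl)

  δ-out-in-adjacent : ∀ {i j} → σ i ≡ true → σ j ≡ false → RimAdjacent i j → δ (suc i) (suc j) ≡ 1
  δ-out-in-adjacent {i} {j} ei ej adj with i ≟ j
  ... | yes refl = ⊥-elim (true≢false (trans (sym ei) ej))
  ... | no _ rewrite ei | ej with rimAdjacent? i j
  ...   | yes _   = refl
  ...   | no ¬adj = ⊥-elim (¬adj adj)

  δ-out-in-one⇒adjacent : ∀ {i j} → σ i ≡ true → σ j ≡ false → δ (suc i) (suc j) ≡ 1 → RimAdjacent i j
  δ-out-in-one⇒adjacent {i} {j} ei ej δ≡1 with i ≟ j
  ... | yes refl = ⊥-elim (true≢false (trans (sym ei) ej))
  ... | no _ rewrite ei | ej with rimAdjacent? i j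
  ...   | yes adj = adj
  ...   | no _    = case δ≡1 of λ ()

  δ-triangle : ∀ {u v} → WheelArc u v → ∀ b → δ u b ≤ suc (δ v b)
  δ-triangle (centre→out ej) zero = z≤n
  δ-triangle (centre→out {j} ej) (suc l) with j ≟ l
  ... | yes refl rewrite ej = ≤-refl
  ... | no _ = ≤-trans (if≤2 (σ l)) (s≤s (1≤rimDistance (σ j) (σ l) _))
  δ-triangle (in→centre ei) zero rewrite ei = ≤-refl
  δ-triangle (in→centre {i} ei) (suc l) with i ≟ l
  ... | yes _ = z≤n
  ... | no _ rewrite ei with σ l
  ...   | true  = ≤-refl
  ...   | false = ≤-refl
  δ-triangle (out→in ei ej _) zero rewrite ei | ej = ≤-refl
  δ-triangle (out→in {i} {j} ei ej adj) (suc l) with j ≟ l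
  ... | yes refl = ≤-reflexive (δ-out-in-adjacent ei ej adj)
  ... | no _ rewrite ej with σ l | i ≟ l
  ...   | _     | yes _ = z≤n
  ...   | false | no _  = rimDistance≤4 (σ i) false _
  ...   | true  | no _  rewrite ei = ≤-refl

  distanceFromIn : Fin (suc N) → ℕ
  distanceFromIn zero    = 1
  distanceFromIn (suc l) = if σ l then 2 else 3

  δ-from-in : ∀ {i} b → σ i ≡ false → b ≢ suc i → δ (suc i) b ≡ distanceFromIn b
  δ-from-in zero ei _ rewrite ei = refl
  δ-from-in {i} (suc l) ei l≢i with i ≟ l
  ... | yes refl = ⊥-elim (l≢i refl)
  ... | no _ rewrite ei with σ l
  ...   | true  = refl
  ...   | false = refl

  δ-in-in : ∀ {i j} → σ i ≡ false → σ j ≡ false → i ≢ j → δ (suc i) (suc j) ≡ 3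
  δ-in-in {i} {j} ei ej i≢j rewrite δ-from-in (suc j) ei (i≢j ∘ sym ∘ suc-injective) | ej = refl

  kind : Fin (suc N) → Maybe Bool
  kind zero    = nothing
  kind (suc i) = just (σ i)

  -- An In vertex is at distance 2 from the centre, 0 or 3 from In vertices, 1 or 4 from Out vertices.
  kindFromDistance : ℕ → Maybe Bool
  kindFromDistance 1 = just true
  kindFromDistance 2 = nothing
  kindFromDistance 4 = just true
  kindFromDistance _ = just false

  kind-from-δ-to-in : ∀ {j} u → σ j ≡ false → kindFromDistance (δ u (suc j)) ≡ kind u
  kind-from-δ-to-in zero ej rewrite ej = refl
  kind-from-δ-to-in {j} (suc i) ej with i ≟ j
  ... | yes refl rewrite ej = refl
  ... | no _ rewrite ej with σ i | rimAdjacent? i j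
  ...   | true  | yes _ = refl
  ...   | true  | no _  = refl
  ...   | false | _     = refl

  inVertices : Subset (suc N)
  inVertices = outside ∷ tabulate (not ∘ σ)

  in∈inVertices : ∀ {j} → σ j ≡ false → suc j ∈ inVertices
  in∈inVertices {j} ej = there (lookup⇒[]= j _ (trans (lookup∘tabulate (not ∘ σ) j) (cong not ej)))

  inVertices-in : ∀ {j} → suc j ∈ inVertices → σ j ≡ false
  inVertices-in {j} (there j∈) = not-injective (trans (sym (lookup∘tabulate (not ∘ σ) j)) ([]=⇒lookup j∈))

module WheelDistance {N} {o : Orientation N} (c3 : C3Simple o)
                     (σ : Fin N → Bool) (spoke≡σ : ∀ i → spoke o i ≡ σ i) where

  open C3Wheel c3
  open WheelGraph σ public

  σ-next : ∀ i → σ (next i) ≡ not (σ i)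
  σ-next i = trans (sym (spoke≡σ (next i))) (trans (spoke-next i) (cong not (spoke≡σ i)))

  rim≡σ : ∀ i → rim o i ≡ σ i
  rim≡σ i = trans (rim≡spoke i) (spoke≡σ i)

  arc⇒wheelArc : ∀ {u v} → Arc o u v → WheelArc u v
  arc⇒wheelArc (spokeOut i e) = centre→out (trans (sym (spoke≡σ i)) e)
  arc⇒wheelArc (spokeIn i e)  = in→centre (trans (sym (spoke≡σ i)) e)
  arc⇒wheelArc (rimFwd i e)   = out→in ei (trans (σ-next i) (cong not ei)) (inj₁ refl)
    where ei = trans (sym (rim≡σ i)) e
  arc⇒wheelArc (rimBwd i e)   = out→in (trans (σ-next i) (cong not ei)) ei (inj₂ refl)
    where ei = trans (sym (rim≡σ i)) e

  wheelArc⇒arc : ∀ {u v} → WheelArc u v → Arc o u v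
  wheelArc⇒arc (centre→out {j} ej)              = spokeOut j (trans (spoke≡σ j) ej)
  wheelArc⇒arc (in→centre {i} ei)               = spokeIn i (trans (spoke≡σ i) ei)
  wheelArc⇒arc (out→in {i} ei _ (inj₁ refl))     = rimFwd i (trans (rim≡σ i) ei)
  wheelArc⇒arc (out→in {j = j} _ ej (inj₂ refl)) = rimBwd j (trans (rim≡σ j) ej)

  arc-path : ∀ {u v} → WheelArc u v → Path o 1 u v
  arc-path uv = step (wheelArc⇒arc uv) here

  out⇝centre : ∀ {i} → σ i ≡ true → Path o 2 (suc i) zero
  out⇝centre {i} ei = step (wheelArc⇒arc (out→in ei (trans (σ-next i) (cong not ei)) (inj₁ refl)))
                           (arc-path (in→centre (trans (σ-next i) (cong not ei))))

  centre⇝in : ∀ {j} → σ j ≡ false → Path o 2 zero (suc j)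
  centre⇝in {j} ej = step (wheelArc⇒arc (centre→out (trans (σ-next j) (cong not ej))))
                          (arc-path (out→in (trans (σ-next j) (cong not ej)) ej (inj₂ refl)))

  δ-path : ∀ u b → Path o (δ u b) u b
  δ-path zero zero = here
  δ-path zero (suc j) with σ j in ej
  ... | true  = arc-path (centre→out ej)
  ... | false = centre⇝in ej
  δ-path (suc i) zero with σ i in ei
  ... | true  = out⇝centre ei
  ... | false = arc-path (in→centre ei)
  δ-path (suc i) (suc j) with i ≟ j
  ... | yes refl = here
  ... | no _ with σ i in ei | σ j in ej
  ...   | true  | true  = out⇝centre ei ++ᵖ arc-path (centre→out ej)
  ...   | false | false = arc-path (in→centre ei) ++ᵖ centre⇝in ej
  ...   | false | true  = arc-path (in→centre ei) ++ᵖ arc-path (centre→out ej)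
  ...   | true  | false with rimAdjacent? i j
  ...     | yes adj = arc-path (out→in ei ej adj)
  ...     | no _    = out⇝centre ei ++ᵖ centre⇝in ej

  δ-minimal : ∀ {k u b} → Path o k u b → δ u b ≤ k
  δ-minimal {b = b} here        = ≤-reflexive (δ-refl b)
  δ-minimal {b = b} (step uv p) = ≤-trans (δ-triangle (arc⇒wheelArc uv) b) (s≤s (δ-minimal p))

  δ-dist : ∀ u b → Dist o u b (δ u b)
  δ-dist u b = δ-path u b , λ _ → δ-minimal

  dist⇒≡δ : ∀ {u b k} → Dist o u b k → k ≡ δ u b
  dist⇒≡δ {u} {b} (p , shortest) = ≤-antisym (shortest _ (δ-path u b)) (δ-minimal p)

  sameRep⇒δ≡ : ∀ {B u v} → SameRep o B u v → ∀ {b} → b ∈ B → δ u b ≡ δ v b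
  sameRep⇒δ≡ same {b} b∈B with same b b∈B
  ... | _ , u-dist , v-dist = trans (sym (dist⇒≡δ u-dist)) (dist⇒≡δ v-dist)

  δ≡⇒twins : ∀ {u v} → (∀ b → b ≢ u → b ≢ v → δ u b ≡ δ v b) → Twins o u v
  δ≡⇒twins {u} {v} δ≡ b b≢u b≢v =
    δ u b , δ-dist u b , subst (Dist o v b) (sym (δ≡ b b≢u b≢v)) (δ-dist v b)

  in-vertices-twins : ∀ {u v} → u ∈ inVertices → v ∈ inVertices → Twins o u v
  in-vertices-twins {suc i} {suc j} i∈ j∈ = δ≡⇒twins λ b b≢i b≢j →
    trans (δ-from-in b (inVertices-in i∈) b≢i) (sym (δ-from-in b (inVertices-in j∈) b≢j))

module EvenWheel {m} {o : Orientation (suc m)} (c3 : C3Simple o) where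

  open WheelDistance c3 (spoke o) (λ _ → refl) public

  ∣inVertices∣≡half : ∀ k → suc m ≡ k * 2 → ∣ inVertices ∣ ≡ k
  ∣inVertices∣≡half k n≡2k = ∣alternating∣≡half k n≡2k (not ∘ spoke o) alternating
    where
    alternating : Alternating (not ∘ spoke o)
    alternating i j j≡i+1 = cong not (trans (cong (spoke o) (sym (next-of-toℕ-suc j≡i+1))) (σ-next i))

  dim-lower-bound : ∀ k → suc m ≡ k * 2 → ∀ B → Resolving o B → k ∸ 1 ≤ ∣ B ∣
  dim-lower-bound k n≡2k B resolving =
    m≤n+o⇒m∸n≤o k 1 (subst (_≤ suc ∣ B ∣) (∣inVertices∣≡half k n≡2k)
                             (twin-class-bound resolving in-vertices-twins))

  next-in : ∀ {i} → spoke o i ≡ true → spoke o (next i) ≡ false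
  next-in {i} ei = trans (σ-next i) (cong not ei)

  prev-in : ∀ {p i} → next p ≡ i → spoke o i ≡ true → spoke o p ≡ false
  prev-in {p} refl ei = not-injective (trans (sym (σ-next p)) ei)

  module AllButOneIn (4≤m : 4 ≤ m) (t₀ : Fin (suc m)) (t₀-in : spoke o t₀ ≡ false) where

    resolvingSet : Subset (suc (suc m))
    resolvingSet = inVertices - suc t₀

    ∣resolvingSet∣ : ∀ k → suc m ≡ k * 2 → ∣ resolvingSet ∣ ≡ k ∸ 1
    ∣resolvingSet∣ k n≡2k =
      cong (_∸ 1) (trans (sym (∣p∣≡1+∣p-x∣ (in∈inVertices t₀-in))) (∣inVertices∣≡half k n≡2k))

    Indistinguishable : Fin (suc (suc m)) → Fin (suc (suc m)) → Set
    Indistinguishable u v = ∀ j → spoke o j ≡ false → j ≢ t₀ → δ u (suc j) ≡ δ v (suc j)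

    NeighboursAgree : Fin (suc m) → Fin (suc m) → Set
    NeighboursAgree i i' = ∀ j → spoke o j ≡ false → j ≢ t₀ → RimAdjacent i j → RimAdjacent i' j

    2≤m : 2 ≤ m
    2≤m = ≤-trans (s≤s (s≤s z≤n)) 4≤m

    -- next i is a common neighbour, so i' = i or i' = next² i. In the second case the neighbour
    -- next i' = next³ i of i', or if that is t₀ the neighbour prev i of i, would have to be a
    -- neighbour of both, which is impossible on a rim of length at least 5.
    neighbours-agree⇒≡′ : ∀ {i i'} → spoke o i ≡ true → spoke o i' ≡ true → next i ≢ t₀ →
                          NeighboursAgree i i' → NeighboursAgree i' i → i ≡ i'
    neighbours-agree⇒≡′ {i} {i'} ei ei' next-i≢t₀ agree agree′
      with agree (next i) (next-in ei) next-i≢t₀ (inj₁ refl)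
    ... | inj₁ e = next-injective e
    ... | inj₂ refl with next i' ≟ t₀
    ...   | no next-i'≢t₀ with agree′ (next i') (next-in ei') next-i'≢t₀ (inj₁ refl)
    ...     | inj₁ e = sym (next-injective e)
    ...     | inj₂ e = ⊥-elim (next⁴≢id 4≤m i (sym e))
    neighbours-agree⇒≡′ {i} ei ei' _ agree _ | inj₂ refl | yes refl with next-surjective i
    ... | p , refl with agree p (prev-in refl ei) (next⁴≢id 4≤m p ∘ sym) (inj₂ refl)
    ...   | inj₁ e = ⊥-elim (next⁴≢id 4≤m p (sym e))
    ...   | inj₂ e = sym e

    neighbours-agree⇒≡ : ∀ {i i'} → spoke o i ≡ true → spoke o i' ≡ true →
                         NeighboursAgree i i' → NeighboursAgree i' i → i ≡ i'
    neighbours-agree⇒≡ {i} {i'} ei ei' agree agree′ with next i ≟ t₀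
    ... | no next-i≢t₀ = neighbours-agree⇒≡′ ei ei' next-i≢t₀ agree agree′
    ... | yes refl with next-surjective i
    ...   | p , refl with agree p (prev-in refl ei) (next²≢id 2≤m p ∘ sym) (inj₂ refl)
    ...     | inj₁ refl = sym (neighbours-agree⇒≡′ ei' ei (next²≢id 2≤m (next i') ∘ sym) agree′ agree)
    ...     | inj₂ e    = sym e

    indistinguishable⇒neighboursAgree : ∀ {i i'} → spoke o i ≡ true → spoke o i' ≡ true →
                                        Indistinguishable (suc i) (suc i') → NeighboursAgree i i'
    indistinguishable⇒neighboursAgree ei ei' agree j ej j≢t₀ adj =
      δ-out-in-one⇒adjacent ei' ej (trans (sym (agree j ej j≢t₀)) (δ-out-in-adjacent ei ej adj))

    in-vertices-separated : ∀ {i i'} → spoke o i ≡ false → spoke o i' ≡ false →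
                            Indistinguishable (suc i) (suc i') → i ≡ i'
    in-vertices-separated {i} {i'} ei ei' agree with i ≟ i' | i ≟ t₀
    ... | yes i≡i' | _        = i≡i'
    ... | no i≢i'  | no i≢t₀  =
      case trans (sym (δ-refl (suc i))) (trans (agree i ei i≢t₀) (δ-in-in ei' ei (i≢i' ∘ sym))) of λ ()
    ... | no i≢i'  | yes refl =
      case trans (sym (δ-in-in ei ei' i≢i')) (trans (agree i' ei' (i≢i' ∘ sym)) (δ-refl (suc i'))) of λ ()

    rim-indistinguishable⇒≡ : ∀ {i i'} b b' → spoke o i ≡ b → spoke o i' ≡ b' → b ≡ b' →
                              Indistinguishable (suc i) (suc i') → i ≡ i'
    rim-indistinguishable⇒≡ false false ei ei' _ agree = in-vertices-separated ei ei' agree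
    rim-indistinguishable⇒≡ true  true  ei ei' _ agree = neighbours-agree⇒≡ ei ei'
      (indistinguishable⇒neighboursAgree ei ei' agree)
      (indistinguishable⇒neighboursAgree ei' ei λ j ej j≢t₀ → sym (agree j ej j≢t₀))

    indistinguishable⇒≡ : ∀ u v → kind u ≡ kind v → Indistinguishable u v → u ≡ v
    indistinguishable⇒≡ zero    zero     _     _     = refl
    indistinguishable⇒≡ (suc i) (suc i') kind≡ agree =
      cong suc (rim-indistinguishable⇒≡ (spoke o i) (spoke o i') refl refl (just-injective kind≡) agree)

    j₁ : Fin (suc m)
    j₁ = next (next t₀)

    j₁-in : spoke o j₁ ≡ false
    j₁-in = next-in (trans (σ-next t₀) (cong not t₀-in))

    resolving : Resolving o resolvingSet
    resolving u v same = indistinguishable⇒≡ u v kind≡ agree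
      where
      agree : Indistinguishable u v
      agree j ej j≢t₀ = sameRep⇒δ≡ same (x∈p∧x≢y⇒x∈p-y (in∈inVertices ej) (j≢t₀ ∘ suc-injective))

      kind≡ : kind u ≡ kind v
      kind≡ = trans (sym (kind-from-δ-to-in u j₁-in))
                (trans (cong kindFromDistance (agree j₁ j₁-in (next²≢id 2≤m t₀))) (kind-from-δ-to-in v j₁-in))

  some-in : ∃ λ t → spoke o t ≡ false
  some-in with spoke o zero in e
  ... | true  = next zero , next-in e
  ... | false = zero , e

  dim-even-wheel : 4 ≤ m → ∀ k → suc m ≡ k * 2 → DimIs o (k ∸ 1)
  dim-even-wheel 4≤m k n≡2k with some-in
  ... | t₀ , t₀-in = (resolvingSet , resolving , ∣resolvingSet∣ k n≡2k) , dim-lower-bound k n≡2k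
    where open AllButOneIn 4≤m t₀ t₀-in

alternate : Bool → Fin 4 → Bool
alternate s zero                   = s
alternate s (suc zero)             = not s
alternate s (suc (suc zero))       = s
alternate s (suc (suc (suc zero))) = not s

module Wheel₄Distances (s : Bool) where
  open WheelGraph (alternate s) public

  v₁ v₂ v₃ v₄ : Fin 5
  v₁ = suc zero
  v₂ = suc (suc zero)
  v₃ = suc (suc (suc zero))
  v₄ = suc (suc (suc (suc zero)))

  Separated : Set
  Separated = ∀ u v → δ u v₁ ≡ δ v v₁ → δ u v₂ ≡ δ v v₂ → u ≡ v

  separated? : Dec Separated
  separated? = all? λ u → all? λ v → (δ u v₁ ℕ.≟ δ v v₁) →-dec ((δ u v₂ ℕ.≟ δ v v₂) →-dec (u ≟ v))

  SameKindTwins : Set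
  SameKindTwins = ∀ i j → alternate s i ≡ alternate s j →
                  ∀ b → b ≢ suc i → b ≢ suc j → δ (suc i) b ≡ δ (suc j) b

  sameKindTwins? : Dec SameKindTwins
  sameKindTwins? = all? λ i → all? λ j → (alternate s i Bool.≟ alternate s j) →-dec all? λ b →
    ¬? (b ≟ suc i) →-dec (¬? (b ≟ suc j) →-dec (δ (suc i) b ℕ.≟ δ (suc j) b))

separated₄ : ∀ s → Wheel₄Distances.Separated s
separated₄ true  = toWitness {a? = Wheel₄Distances.separated? true} _
separated₄ false = toWitness {a? = Wheel₄Distances.separated? false} _

sameKindTwins₄ : ∀ s → Wheel₄Distances.SameKindTwins s
sameKindTwins₄ true  = toWitness {a? = Wheel₄Distances.sameKindTwins? true} _
sameKindTwins₄ false = toWitness {a? = Wheel₄Distances.sameKindTwins? false} _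

module Wheel₄ {o : Orientation 4} (c3 : C3Simple o) where

  open C3Wheel c3

  spoke≡alternate : ∀ i → spoke o i ≡ alternate (spoke o zero) i
  spoke≡alternate zero                   = refl
  spoke≡alternate (suc zero)             = spoke-next zero
  spoke≡alternate (suc (suc zero))       =
    trans (spoke-next (suc zero)) (trans (cong not (spoke-next zero)) (not-involutive _))
  spoke≡alternate (suc (suc (suc zero))) =
    trans (spoke-next (suc (suc zero))) (cong not (spoke≡alternate (suc (suc zero))))

  open WheelDistance c3 (alternate (spoke o zero)) spoke≡alternate
  open Wheel₄Distances (spoke o zero) using (v₁; v₂; v₃; v₄)

  resolvingSet₄ : Subset 5
  resolvingSet₄ = outside ∷ inside ∷ inside ∷ outside ∷ outside ∷ []

  resolving₄ : Resolving o resolvingSet₄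
  resolving₄ u v same =
    separated₄ (spoke o zero) u v (sameRep⇒δ≡ same (there here)) (sameRep⇒δ≡ same (there (there here)))

  twins₄ : ∀ i j → alternate (spoke o zero) i ≡ alternate (spoke o zero) j → Twins o (suc i) (suc j)
  twins₄ i j same-kind = δ≡⇒twins (sameKindTwins₄ (spoke o zero) i j same-kind)

  two-elements : ∀ {B : Subset 5} → v₁ ∈ B ⊎ v₃ ∈ B → v₂ ∈ B ⊎ v₄ ∈ B → 2 ≤ ∣ B ∣
  two-elements (inj₁ x) (inj₁ y) = 2≤∣p∣ x y λ ()
  two-elements (inj₁ x) (inj₂ y) = 2≤∣p∣ x y λ ()
  two-elements (inj₂ x) (inj₁ y) = 2≤∣p∣ x y λ ()
  two-elements (inj₂ x) (inj₂ y) = 2≤∣p∣ x y λ ()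

  dim₄ : DimIs o 2
  dim₄ = (resolvingSet₄ , resolving₄ , refl) , λ B resolving →
    two-elements (twins-meet resolving (twins₄ zero (suc (suc zero)) refl) λ ())
                 (twins-meet resolving (twins₄ (suc zero) (suc (suc (suc zero))) refl) λ ())

mainTheorem2 : (n k : ℕ) → 4 ≤ n → n ≡ 2 * k → (o : Orientation n) → C3Simple o →
    (n ≡ 4 → DimIs o 2) × (6 ≤ n → DimIs o (k ∸ 1))
mainTheorem2 zero    _ ()  _    _ _
mainTheorem2 (suc m) k _   n≡2k o c3 =
  (λ { refl → Wheel₄.dim₄ c3 }) ,
  λ { (s≤s 5≤m) → EvenWheel.dim-even-wheel c3 (≤-trans (n≤1+n 4) 5≤m) k (trans n≡2k (*-comm 2 k)) }
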